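{- For each integer $a\neq 0$ the set $\Theta_a$ is finite. Moreover, $\Theta_{ -2}=\{(0,\pm1,0)\}$, $\Theta_{ -1}=\{(\pm1,\pm1,0),(0,\pm1,\pm1)\}$, $\Theta_0=\{(x_1,x_2,x_3)\in\mathbb{Z}^3: |x_1|=|x_2|=|x_3|\}$, $\Theta_1=\{(\pm1,0,0),(0,0,\pm1)\}$, and $\Theta_2=\{(\pm2,\pm1,0),(0,\pm1,\pm2),(\pm1,0,\pm1)\}$, where all $\pm$ signs are independent.
   Context: For an integer $a$, $\Gamma_a$ is the set of $(x_1,x_2,x_3)\in\mathbb{Z}^3$ with $x_1^2-2x_2^2+x_3^2=a$. Let $J=\begin{pmatrix}0&0&1\\0&1&0\\1&0&0\end{pmatrix}$ (so $J(x_1,x_2,x_3)^T=(x_3,x_2,x_1)^T$). Let $\mathcal{C}=\{x\in\mathbb{Z}^3: |x_1|\le|x_2| \text{ or } |x_1|\ge 2|x_2|\}$. Define $\Theta_a=\{x\in\Gamma_a: |x_2|\ge\max\{|x_1|,|x_3|\}\}$ if $a<0$, and $\Theta_a=\{x\in\Gamma_a: x\in\mathcal{C}\text{ and }Jx\in\mathcal{C}\}$ if $a\ge 0$. -}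

module Defs where

open import Data.Nat using (ℕ; _≤_) renaming (_*_ to _*ℕ_)
open import Data.Integer using (ℤ; +_; -[1+_]; _+_; _-_; _*_; ∣_∣)
open import Data.Product using (_×_; _,_)
open import Data.Sum using (_⊎_)
open import Relation.Binary.PropositionalEquality using (_≡_)

ℤ³ : Set
ℤ³ = ℤ × ℤ × ℤ

Γ : ℤ → ℤ³ → Set
Γ a (x₁ , x₂ , x₃) = x₁ * x₁ - + 2 * (x₂ * x₂) + x₃ * x₃ ≡ a

J : ℤ³ → ℤ³
J (x₁ , x₂ , x₃) = (x₃ , x₂ , x₁)

𝒞 : ℤ³ → Set
𝒞 (x₁ , x₂ , x₃) = (∣ x₁ ∣ ≤ ∣ x₂ ∣) ⊎ (2 *ℕ ∣ x₂ ∣ ≤ ∣ x₁ ∣)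

x₂-dominant : ℤ³ → Set
x₂-dominant (x₁ , x₂ , x₃) = (∣ x₁ ∣ ≤ ∣ x₂ ∣) × (∣ x₃ ∣ ≤ ∣ x₂ ∣)

Θ : ℤ → ℤ³ → Set
Θ a@(-[1+ _ ]) x = Γ a x × x₂-dominant x
Θ a@(+ _)      x = Γ a x × 𝒞 x × 𝒞 (J x)

AbsIs : ℕ → ℕ → ℕ → ℤ³ → Set
AbsIs i j k (x₁ , x₂ , x₃) = (∣ x₁ ∣ ≡ i) × (∣ x₂ ∣ ≡ j) × (∣ x₃ ∣ ≡ k)

module Submission where

-- Both the equation of Γ_a and the conditions defining Θ_a only see the
-- absolute values (a, b, c) = (|x₁|, |x₂|, |x₃|), so Θ_a is the preimage of a
-- set Θℕ_a ⊆ ℕ³ described by  a² + c² + (k+1) = 2b²,  a, c ≤ b  on the level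
-- a = −(k+1), and by  a² + c² = m + 2b²  together with  𝒞 : a ≤ b ∨ 2b ≤ a
-- (and the same for c) on the level a = m ≥ 0.  The arithmetic core is:
--
--   * if a, c ≤ b, then either a = b = c, or a² + c² falls short of 2b² by
--     at least b (a square below b² is at least b below it);
--   * if 2b ≤ a, then a² ≥ 4b², so the level m absorbs 2b².
--
-- On a level a ≠ 0 this confines (|x₁|, |x₂|, |x₃|) to an explicit box, which
-- gives finiteness through the list of integer points of a cube.  On the
-- levels −2, −1, 1, 2 the box is tiny, and the classification is obtained by
-- letting Agda evaluate a decision procedure over the box.  On the level 0 the
-- first alternative gives the diagonal |x₁| = |x₂| = |x₃| and the second
-- forces b = 0, hence everything is 0.

open import Defs
open import Data.Nat
  using (ℕ; zero; suc; _+_; _*_; _≤_; _<_; z≤n; s≤s; _≤?_)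
  renaming (_≟_ to _≟ℕ_)
open import Data.Nat.Properties
  using ( ≤-refl; ≤-trans; ≤-reflexive; m≤m+n; m≤n+m; +-mono-≤; +-monoˡ-≤
        ; *-mono-≤; +-cancelʳ-≤; +-cancelˡ-≤; +-assoc; +-comm; m≤n⇒m<n∨m≡n
        ; n≤0⇒n≡0; m+1+n≢m; m≤m*n; module ≤-Reasoning)
open import Data.Nat.Tactic.RingSolver using (solve)
open import Data.Integer as ℤ using (ℤ; +_; -[1+_]; ∣_∣)
import Data.Integer.Properties as ℤₚ
import Data.Integer.Tactic.RingSolver as ℤ-Solver
open import Algebra.Properties.AbelianGroup ℤₚ.+-0-abelianGroup using (∙-cancelʳ)
open import Data.Fin using (Fin; toℕ; fromℕ<)
open import Data.Fin.Properties using (all?; toℕ-fromℕ<)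
open import Data.Product using (_×_; _,_; Σ; proj₁; proj₂)
open import Data.Product.Function.NonDependent.Propositional using (_×-⇔_)
open import Data.Sum using (_⊎_; inj₁; inj₂)
open import Data.Empty using (⊥-elim)
open import Data.List using (List; _∷_; []; map; _++_; upTo; cartesianProduct)
open import Data.List.Membership.Propositional using (_∈_)
open import Data.List.Membership.Propositional.Properties
  using (∈-upTo⁺; ∈-map⁺; ∈-++⁺ˡ; ∈-++⁺ʳ; ∈-cartesianProduct⁺)
open import Function.Bundles using (_⇔_; mk⇔; Equivalence)
open import Function.Construct.Composition using (_⇔-∘_)
open import Function.Construct.Identity using (⇔-id)
open import Relation.Nullary using (Dec)
open import Relation.Nullary.Decidable using (True; toWitness; _×-dec_; _⊎-dec_; _→-dec_)
open import Relation.Binary.PropositionalEquality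
  using (_≡_; _≢_; refl; sym; trans; cong; cong₂; module ≡-Reasoning)

double : ∀ n → n + n ≡ 2 * n
double n = solve (n ∷ [])

n≤n*n : ∀ n → n ≤ n * n
n≤n*n zero    = z≤n
n≤n*n (suc n) = m≤m*n (suc n) (suc n)

square-gap : ∀ {a b} → a < b → a * a + b ≤ b * b
square-gap {a} {suc t} (s≤s a≤t) = begin
  a * a + suc t      ≤⟨ +-monoˡ-≤ (suc t) (*-mono-≤ a≤t a≤t) ⟩
  t * t + suc t      ≤⟨ m≤m+n (t * t + suc t) t ⟩
  t * t + suc t + t  ≡⟨ solve (t ∷ []) ⟩
  suc t * suc t      ∎
  where open ≤-Reasoning

square-deficit : ∀ {a b c} → a ≤ b → c ≤ b →
                 (a * a + c * c + b ≤ 2 * (b * b)) ⊎ (a ≡ b × c ≡ b)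
square-deficit {a} {b} {c} a≤b c≤b with m≤n⇒m<n∨m≡n a≤b | m≤n⇒m<n∨m≡n c≤b
... | inj₁ a<b | _ = inj₁ (begin
  a * a + c * c + b   ≡⟨ solve (a ∷ b ∷ c ∷ []) ⟩
  a * a + b + c * c   ≤⟨ +-mono-≤ (square-gap a<b) (*-mono-≤ c≤b c≤b) ⟩
  b * b + b * b       ≡⟨ double (b * b) ⟩
  2 * (b * b)         ∎)
  where open ≤-Reasoning
... | inj₂ _ | inj₁ c<b = inj₁ (begin
  a * a + c * c + b   ≡⟨ +-assoc (a * a) (c * c) b ⟩
  a * a + (c * c + b) ≤⟨ +-mono-≤ (*-mono-≤ a≤b a≤b) (square-gap c<b) ⟩
  b * b + b * b       ≡⟨ double (b * b) ⟩
  2 * (b * b)         ∎)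
  where open ≤-Reasoning
... | inj₂ a≡b | inj₂ c≡b = inj₂ (a≡b , c≡b)

negative-bound : ∀ {a b c} k → a ≤ b → c ≤ b →
                 a * a + c * c + suc k ≡ 2 * (b * b) → b ≤ suc k
negative-bound {a} {b} {c} k a≤b c≤b eq with square-deficit a≤b c≤b
... | inj₁ deficit =
  +-cancelˡ-≤ (a * a + c * c) b (suc k) (≤-trans deficit (≤-reflexive (sym eq)))
... | inj₂ (refl , refl) =
  ⊥-elim (m+1+n≢m (2 * (b * b)) (trans (cong (_+ suc k) (sym (double (b * b)))) eq))

balanced : ∀ {a b c} m → a ≤ b → c ≤ b → a * a + c * c ≡ m + 2 * (b * b) →
           a ≡ b × c ≡ b
balanced {a} {b} {c} m a≤b c≤b eq with square-deficit a≤b c≤b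
... | inj₂ diagonal = diagonal
... | inj₁ deficit = trans (n≤0⇒n≡0 (≤-trans a≤b b≤0)) (sym (n≤0⇒n≡0 b≤0))
                   , trans (n≤0⇒n≡0 (≤-trans c≤b b≤0)) (sym (n≤0⇒n≡0 b≤0))
  where
  open ≤-Reasoning
  m+b≤0 : m + b ≤ 0
  m+b≤0 = +-cancelʳ-≤ (2 * (b * b)) (m + b) 0 (begin
    m + b + 2 * (b * b)   ≡⟨ solve (m ∷ b ∷ []) ⟩
    m + 2 * (b * b) + b   ≡⟨ cong (_+ b) (sym eq) ⟩
    a * a + c * c + b     ≤⟨ deficit ⟩
    2 * (b * b)           ∎)
  b≤0 : b ≤ 0
  b≤0 = ≤-trans (m≤n+m b m) m+b≤0

-- On a level m ≥ 0 with 2b ≤ a, the level absorbs 2b², since a² ≥ 4b².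
lopsided : ∀ {a b c} m → 2 * b ≤ a → a * a + c * c ≡ m + 2 * (b * b) →
           2 * (b * b) ≤ m
lopsided {a} {b} {c} m 2b≤a eq = +-cancelʳ-≤ (2 * (b * b)) (2 * (b * b)) m (begin
  2 * (b * b) + 2 * (b * b) ≡⟨ solve (b ∷ []) ⟩
  (2 * b) * (2 * b)         ≤⟨ *-mono-≤ 2b≤a 2b≤a ⟩
  a * a                     ≤⟨ m≤m+n (a * a) (c * c) ⟩
  a * a + c * c             ≡⟨ eq ⟩
  m + 2 * (b * b)           ∎)
  where open ≤-Reasoning

-- The condition 𝒞 read on absolute values:  a ≤ b  or  2b ≤ a.
Cond : ℕ → ℕ → Set
Cond a b = a ≤ b ⊎ 2 * b ≤ a

Cond? : ∀ a b → Dec (Cond a b)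
Cond? a b = a ≤? b ⊎-dec 2 * b ≤? a

nonnegative-shape : ∀ {a b c} m → a * a + c * c ≡ m + 2 * (b * b) →
                    Cond a b → Cond c b → (a ≡ b × c ≡ b) ⊎ (2 * (b * b) ≤ m)
nonnegative-shape m eq (inj₁ a≤b) (inj₁ c≤b) = inj₁ (balanced m a≤b c≤b eq)
nonnegative-shape {a} {b} {c} m eq (inj₂ 2b≤a) _ =
  inj₂ (lopsided {a} {b} {c} m 2b≤a eq)
nonnegative-shape {a} {b} {c} m eq (inj₁ _) (inj₂ 2b≤c) =
  inj₂ (lopsided {c} {b} {a} m 2b≤c (trans (+-comm (c * c) (a * a)) eq))

absorbed-bound : ∀ {a b c} m → a * a + c * c ≡ m + 2 * (b * b) →
                 2 * (b * b) ≤ m → a ≤ 2 * m × b ≤ 2 * m × c ≤ 2 * m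
absorbed-bound {a} {b} {c} m eq 2b²≤m =
    ≤-trans (n≤n*n a) (≤-trans (m≤m+n (a * a) (c * c)) sum≤2m)
  , ≤-trans (n≤n*n b) b²≤2m
  , ≤-trans (n≤n*n c) (≤-trans (m≤n+m (c * c) (a * a)) sum≤2m)
  where
  open ≤-Reasoning
  sum≤2m : a * a + c * c ≤ 2 * m
  sum≤2m = begin
    a * a + c * c    ≡⟨ eq ⟩
    m + 2 * (b * b)  ≤⟨ +-mono-≤ (≤-refl {m}) 2b²≤m ⟩
    m + m            ≡⟨ double m ⟩
    2 * m            ∎
  b²≤2m : b * b ≤ 2 * m
  b²≤2m = begin
    b * b            ≤⟨ m≤m+n (b * b) (b * b) ⟩
    b * b + b * b    ≡⟨ double (b * b) ⟩
    2 * (b * b)      ≤⟨ 2b²≤m ⟩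
    m                ≤⟨ m≤m+n m m ⟩
    m + m            ≡⟨ double m ⟩
    2 * m            ∎

-- The conditions defining Θ_z, stated for (a, b, c) = (|x₁|, |x₂|, |x₃|).
Θℕ : ℤ → ℕ → ℕ → ℕ → Set
Θℕ -[1+ k ] a b c = (a * a + c * c + suc k ≡ 2 * (b * b)) × a ≤ b × c ≤ b
Θℕ (+ m)    a b c = (a * a + c * c ≡ m + 2 * (b * b)) × Cond a b × Cond c b

Θℕ? : ∀ z a b c → Dec (Θℕ z a b c)
Θℕ? -[1+ k ] a b c = (a * a + c * c + suc k ≟ℕ 2 * (b * b)) ×-dec a ≤? b ×-dec c ≤? b
Θℕ? (+ m)    a b c = (a * a + c * c ≟ℕ m + 2 * (b * b)) ×-dec Cond? a b ×-dec Cond? c b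

-- The side length of a box containing Θℕ_z for z ≠ 0.
bound : ℤ → ℕ
bound -[1+ k ] = suc k
bound (+ m)    = 2 * m

InBox : ℕ → ℕ → ℕ → ℕ → Set
InBox B a b c = a ≤ B × b ≤ B × c ≤ B

Θℕ-bound : ∀ z {a b c} → z ≢ + 0 → Θℕ z a b c → InBox (bound z) a b c
Θℕ-bound -[1+ k ] _ (eq , a≤b , c≤b) =
  ≤-trans a≤b b≤k+1 , b≤k+1 , ≤-trans c≤b b≤k+1
  where b≤k+1 = negative-bound k a≤b c≤b eq
Θℕ-bound (+ zero) z≢0 _ = ⊥-elim (z≢0 refl)
Θℕ-bound (+ suc k) {b = b} _ (eq , cond₁ , cond₃)
  with nonnegative-shape (suc k) eq cond₁ cond₃
... | inj₂ 2b²≤m = absorbed-bound (suc k) eq 2b²≤m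
... | inj₁ (refl , refl) = ⊥-elim (m+1+n≢m (2 * (b * b)) diagonal-level)
  where
  -- a diagonal point lies on the level 0, not on the level k+1
  diagonal-level : 2 * (b * b) + suc k ≡ 2 * (b * b)
  diagonal-level = begin
    2 * (b * b) + suc k  ≡⟨ +-comm (2 * (b * b)) (suc k) ⟩
    suc k + 2 * (b * b)  ≡⟨ sym eq ⟩
    b * b + b * b        ≡⟨ double (b * b) ⟩
    2 * (b * b)          ∎
    where open ≡-Reasoning

Θℕ-zero : ∀ {a b c} → Θℕ (+ 0) a b c → a ≡ b × b ≡ c
Θℕ-zero (eq , cond₁ , cond₃) with nonnegative-shape 0 eq cond₁ cond₃
... | inj₁ (a≡b , c≡b) = a≡b , sym c≡b
... | inj₂ 2b²≤0 with absorbed-bound 0 eq 2b²≤0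
...   | a≤0 , b≤0 , c≤0 = trans (n≤0⇒n≡0 a≤0) (sym (n≤0⇒n≡0 b≤0))
                        , trans (n≤0⇒n≡0 b≤0) (sym (n≤0⇒n≡0 c≤0))

Θℕ-diagonal : ∀ {a b c} → a ≡ b → b ≡ c → Θℕ (+ 0) a b c
Θℕ-diagonal {a} refl refl = solve (a ∷ []) , inj₁ ≤-refl , inj₁ ≤-refl

Q : ℕ → ℕ → ℕ → ℤ
Q a b c = + (a * a) ℤ.- + (2 * (b * b)) ℤ.+ + (c * c)

square-abs : ∀ x → x ℤ.* x ≡ + (∣ x ∣ * ∣ x ∣)
square-abs (+ zero)   = refl
square-abs (+ suc n)  = refl
square-abs -[1+ n ]   = refl

Γ⇔Q : ∀ z x₁ x₂ x₃ → Γ z (x₁ , x₂ , x₃) ⇔ (Q (∣ x₁ ∣) (∣ x₂ ∣) (∣ x₃ ∣) ≡ z)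
Γ⇔Q z x₁ x₂ x₃ = mk⇔ (trans (sym form≡Q)) (trans form≡Q)
  where
  form≡Q : x₁ ℤ.* x₁ ℤ.- + 2 ℤ.* (x₂ ℤ.* x₂) ℤ.+ x₃ ℤ.* x₃ ≡ Q (∣ x₁ ∣) (∣ x₂ ∣) (∣ x₃ ∣)
  form≡Q = cong₂ ℤ._+_
    (cong₂ ℤ._-_ (square-abs x₁)
                 (trans (cong (+ 2 ℤ.*_) (square-abs x₂)) (sym (ℤₚ.pos-* 2 (∣ x₂ ∣ * ∣ x₂ ∣)))))
    (square-abs x₃)

-- Adding s to  p − s + r  gives  p + r,  so the level z of  p − s + r  is
-- recorded by the natural-number equation  p + r = z + s.
Q-level : ∀ p s r z → (+ p ℤ.- + s ℤ.+ + r ≡ z) ⇔ (+ (p + r) ≡ z ℤ.+ + s)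
Q-level p s r z = mk⇔
  (λ e → trans (sym add-s) (cong (ℤ._+ + s) e))
  (λ e → ∙-cancelʳ (+ s) _ _ (trans add-s e))
  where
  shift : ∀ (P S R : ℤ) → P ℤ.- S ℤ.+ R ℤ.+ S ≡ P ℤ.+ R
  shift = ℤ-Solver.solve-∀
  add-s : + p ℤ.- + s ℤ.+ + r ℤ.+ + s ≡ + (p + r)
  add-s = trans (shift (+ p) (+ s) (+ r)) (sym (ℤₚ.pos-+ p r))

Q-nonnegative : ∀ a b c m → (Q a b c ≡ + m) ⇔ (a * a + c * c ≡ m + 2 * (b * b))
Q-nonnegative a b c m =
  mk⇔ ℤₚ.+-injective (cong (λ n → + n)) ⇔-∘ Q-level (a * a) (2 * (b * b)) (c * c) (+ m)

Q-negative : ∀ a b c k → (Q a b c ≡ -[1+ k ]) ⇔ (a * a + c * c + suc k ≡ 2 * (b * b))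
Q-negative a b c k =
  mk⇔ (λ e → ℤₚ.+-injective (trans (cong (ℤ._+ + suc k) e) (unshift _ _)))
      (λ e → ∙-cancelʳ (+ suc k) _ _ (trans (cong (λ n → + n) e) (sym (unshift _ _))))
  ⇔-∘ Q-level (a * a) (2 * (b * b)) (c * c) -[1+ k ]
  where
  cancel : ∀ (S T : ℤ) → ℤ.- T ℤ.+ S ℤ.+ T ≡ S
  cancel = ℤ-Solver.solve-∀
  unshift : ∀ s t → -[1+ t ] ℤ.+ + s ℤ.+ + suc t ≡ + s
  unshift s t = cancel (+ s) (+ suc t)

Θ⇔Θℕ : ∀ z x₁ x₂ x₃ → Θ z (x₁ , x₂ , x₃) ⇔ Θℕ z (∣ x₁ ∣) (∣ x₂ ∣) (∣ x₃ ∣)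
Θ⇔Θℕ -[1+ k ] x₁ x₂ x₃ =
  (Q-negative (∣ x₁ ∣) (∣ x₂ ∣) (∣ x₃ ∣) k ⇔-∘ Γ⇔Q -[1+ k ] x₁ x₂ x₃) ×-⇔ ⇔-id _
Θ⇔Θℕ (+ m) x₁ x₂ x₃ =
  (Q-nonnegative (∣ x₁ ∣) (∣ x₂ ∣) (∣ x₃ ∣) m ⇔-∘ Γ⇔Q (+ m) x₁ x₂ x₃) ×-⇔ ⇔-id _

Θ-from-abs : ∀ z {i j k} x → AbsIs i j k x → Θℕ z i j k → Θ z x
Θ-from-abs z (x₁ , x₂ , x₃) (refl , refl , refl) = Equivalence.from (Θ⇔Θℕ z x₁ x₂ x₃)

integers-upto : ℕ → List ℤ
integers-upto B = map (λ n → + n) (upTo (suc B)) ++ map -[1+_] (upTo B)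

∈-integers-upto : ∀ {B} z → ∣ z ∣ ≤ B → z ∈ integers-upto B
∈-integers-upto (+ n)    n≤B = ∈-++⁺ˡ (∈-map⁺ (λ n → + n) (∈-upTo⁺ (s≤s n≤B)))
∈-integers-upto {B} -[1+ n ] n<B =
  ∈-++⁺ʳ (map (λ n → + n) (upTo (suc B))) (∈-map⁺ -[1+_] (∈-upTo⁺ n<B))

cube : ℕ → List ℤ³
cube B = cartesianProduct (integers-upto B)
                          (cartesianProduct (integers-upto B) (integers-upto B))

∈-cube : ∀ {B} x₁ x₂ x₃ → InBox B (∣ x₁ ∣) (∣ x₂ ∣) (∣ x₃ ∣) → (x₁ , x₂ , x₃) ∈ cube B
∈-cube x₁ x₂ x₃ (b₁ , b₂ , b₃) =
  ∈-cartesianProduct⁺ (∈-integers-upto x₁ b₁)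
    (∈-cartesianProduct⁺ (∈-integers-upto x₂ b₂) (∈-integers-upto x₃ b₃))

Θ-finite : (z : ℤ) → z ≢ + 0 → Σ (List ℤ³) (λ xs → (x : ℤ³) → Θ z x → x ∈ xs)
Θ-finite z z≢0 = cube (bound z) , λ { (x₁ , x₂ , x₃) θ →
  ∈-cube x₁ x₂ x₃ (Θℕ-bound z z≢0 (Equivalence.to (Θ⇔Θℕ z x₁ x₂ x₃) θ)) }

box? : ∀ B {P : ℕ → ℕ → ℕ → Set} → (∀ a b c → Dec (P a b c)) →
       Dec (∀ (i j k : Fin (suc B)) → P (toℕ i) (toℕ j) (toℕ k))
box? B P? = all? λ i → all? λ j → all? λ k → P? (toℕ i) (toℕ j) (toℕ k)

box-search : ∀ B {P : ℕ → ℕ → ℕ → Set} (P? : ∀ a b c → Dec (P a b c)) →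
             True (box? B P?) → ∀ {a b c} → InBox B a b c → P a b c
box-search B {P} P? verified (a≤B , b≤B , c≤B) =
  at (toℕ-fromℕ< (s≤s a≤B)) (toℕ-fromℕ< (s≤s b≤B)) (toℕ-fromℕ< (s≤s c≤B))
     (toWitness verified (fromℕ< (s≤s a≤B)) (fromℕ< (s≤s b≤B)) (fromℕ< (s≤s c≤B)))
  where
  at : ∀ {a′ b′ c′ a b c} → a′ ≡ a → b′ ≡ b → c′ ≡ c → P a′ b′ c′ → P a b c
  at refl refl refl p = p

-- On a level z ≠ 0, a property T of the point (|x₁|, |x₂|, |x₃|) holds on all
-- of Θ_z as soon as it holds at the points of Θℕ_z in the box, which Agda
-- checks by evaluation.
Θ-search : ∀ z → z ≢ + 0 → {T : ℤ³ → Set} (T? : ∀ x → Dec (T x)) →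
           {verified : True (box? (bound z) (λ a b c →
                        Θℕ? z a b c →-dec T? (+ a , + b , + c)))} →
           ∀ x₁ x₂ x₃ → Θ z (x₁ , x₂ , x₃) → T (+ ∣ x₁ ∣ , + ∣ x₂ ∣ , + ∣ x₃ ∣)
Θ-search z z≢0 T? {verified} x₁ x₂ x₃ θ =
  box-search (bound z) (λ a b c → Θℕ? z a b c →-dec T? (+ a , + b , + c))
             verified (Θℕ-bound z z≢0 θℕ) θℕ
  where θℕ = Equivalence.to (Θ⇔Θℕ z x₁ x₂ x₃) θ

AbsIs? : ∀ i j k x → Dec (AbsIs i j k x)
AbsIs? i j k (x₁ , x₂ , x₃) = ∣ x₁ ∣ ≟ℕ i ×-dec ∣ x₂ ∣ ≟ℕ j ×-dec ∣ x₃ ∣ ≟ℕ k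

Θ-level-minus-two : (x : ℤ³) → Θ -[1+ 1 ] x ⇔ AbsIs 0 1 0 x
Θ-level-minus-two x@(x₁ , x₂ , x₃) = mk⇔
  (Θ-search -[1+ 1 ] (λ ()) (AbsIs? 0 1 0) x₁ x₂ x₃)
  (λ p → Θ-from-abs -[1+ 1 ] x p (refl , z≤n , z≤n))

Θ-level-minus-one : (x : ℤ³) → Θ -[1+ 0 ] x ⇔ (AbsIs 1 1 0 x ⊎ AbsIs 0 1 1 x)
Θ-level-minus-one x@(x₁ , x₂ , x₃) = mk⇔
  (Θ-search -[1+ 0 ] (λ ()) (λ y → AbsIs? 1 1 0 y ⊎-dec AbsIs? 0 1 1 y) x₁ x₂ x₃)
  λ { (inj₁ p) → Θ-from-abs -[1+ 0 ] x p (refl , ≤-refl , z≤n)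
    ; (inj₂ p) → Θ-from-abs -[1+ 0 ] x p (refl , z≤n , ≤-refl) }

Θ-level-zero : (x : ℤ³) → Θ (+ 0) x ⇔ ((∣ proj₁ x ∣ ≡ ∣ proj₁ (proj₂ x) ∣) × (∣ proj₁ (proj₂ x) ∣ ≡ ∣ proj₂ (proj₂ x) ∣))
Θ-level-zero (x₁ , x₂ , x₃) = mk⇔
  (λ θ → Θℕ-zero (Equivalence.to (Θ⇔Θℕ (+ 0) x₁ x₂ x₃) θ))
  (λ (p , q) → Equivalence.from (Θ⇔Θℕ (+ 0) x₁ x₂ x₃) (Θℕ-diagonal p q))

Θ-level-one : (x : ℤ³) → Θ (+ 1) x ⇔ (AbsIs 1 0 0 x ⊎ AbsIs 0 0 1 x)
Θ-level-one x@(x₁ , x₂ , x₃) = mk⇔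
  (Θ-search (+ 1) (λ ()) (λ y → AbsIs? 1 0 0 y ⊎-dec AbsIs? 0 0 1 y) x₁ x₂ x₃)
  λ { (inj₁ p) → Θ-from-abs (+ 1) x p (refl , inj₂ z≤n , inj₁ z≤n)
    ; (inj₂ p) → Θ-from-abs (+ 1) x p (refl , inj₁ z≤n , inj₂ z≤n) }

Θ-level-two : (x : ℤ³) → Θ (+ 2) x ⇔ (AbsIs 2 1 0 x ⊎ AbsIs 0 1 2 x ⊎ AbsIs 1 0 1 x)
Θ-level-two x@(x₁ , x₂ , x₃) = mk⇔
  (Θ-search (+ 2) (λ ())
     (λ y → AbsIs? 2 1 0 y ⊎-dec AbsIs? 0 1 2 y ⊎-dec AbsIs? 1 0 1 y) x₁ x₂ x₃)
  λ { (inj₁ p)        → Θ-from-abs (+ 2) x p (refl , inj₂ ≤-refl , inj₁ z≤n)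
    ; (inj₂ (inj₁ p)) → Θ-from-abs (+ 2) x p (refl , inj₁ z≤n , inj₂ ≤-refl)
    ; (inj₂ (inj₂ p)) → Θ-from-abs (+ 2) x p (refl , inj₂ z≤n , inj₂ z≤n) }

theorem1p2 :
    ((a : ℤ) → a ≢ + 0 → Σ (List ℤ³) (λ xs → (x : ℤ³) → Θ a x → x ∈ xs))
    × ((x : ℤ³) → Θ -[1+ 1 ] x ⇔ AbsIs 0 1 0 x)
    × ((x : ℤ³) → Θ -[1+ 0 ] x ⇔ (AbsIs 1 1 0 x ⊎ AbsIs 0 1 1 x))
    × ((x : ℤ³) → Θ (+ 0) x ⇔ ((∣ proj₁ x ∣ ≡ ∣ proj₁ (proj₂ x) ∣) × (∣ proj₁ (proj₂ x) ∣ ≡ ∣ proj₂ (proj₂ x) ∣)))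
    × ((x : ℤ³) → Θ (+ 1) x ⇔ (AbsIs 1 0 0 x ⊎ AbsIs 0 0 1 x))
    × ((x : ℤ³) → Θ (+ 2) x ⇔ (AbsIs 2 1 0 x ⊎ AbsIs 0 1 2 x ⊎ AbsIs 1 0 1 x))
theorem1p2 = Θ-finite , Θ-level-minus-two , Θ-level-minus-one , Θ-level-zero , Θ-level-one , Θ-level-two
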